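{- There exist subsets $I_1, I_2, I_3 \subseteq [3]$, each of size $2$, such that with $\mathcal I = (I_1, I_2, I_3)$, $R_1 \mid S_1$ is an $\mathcal I$-substructure of $P_2 \mid Q_2$.
   Context: $C_6 = \{(0,0),(0,1),(1,0),(1,2),(2,1),(2,2)\}$, $C_6^*=C_6\setminus\{(0,0)\}$, $S_1 = C_6\times\{0,1,2\}\subseteq\{0,1,2\}^3$, $R_1 = (C_6^*\times\{0,1,2\})\cup(C_6\times\{1,2\})$. $P_2 = \{011,111,120,222,202\}\subseteq\{0,1,2\}^3$ and $Q_2 = P_2\cup\{000\}$. For $I\subseteq[r]$, $\pi_I x=(x_i:i\in I)$. For $P\subsetneq Q\subseteq D_1^{r_1}$, $R\subsetneq S\subseteq D_2^{r_2}$ and $\mathcal I=(I_1,\dots,I_{r_2})$ subsets of $[r_1]$, $P\mid Q$ is an $\mathcal I$-substructure of $R\mid S$ if there exist maps $g_j:D_1^{I_j}\to D_2$ with $(g_1(\pi_{I_1}x),\dots,g_{r_2}(\pi_{I_{r_2}}x))\in R$ for all $x\in P$ and $\in S\setminus R$ for all $x\in Q\setminus P$. -}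

module Defs where

open import Data.Fin using (Fin; zero; suc)
open import Data.Fin.Subset using (Subset; _∈_)
open import Data.Product using (Σ; ∃; _×_; _,_)
open import Data.Sum using (_⊎_)
open import Relation.Nullary using (¬_)
open import Relation.Binary.PropositionalEquality using (_≡_; _≢_)

-- r-tuples over a domain D are functions Fin r → D (coordinates 1..r ↦ indices 0..r-1)
Tuple : Set → (r : _) → Set
Tuple D r = Fin r → D

Rel : Set → (r : _) → Set₁
Rel D r = Tuple D r → Set

Pow : Set → {r : _} → Subset r → Set
Pow D {r} I = Σ (Fin r) (λ i → i ∈ I) → D

π : {D : Set} {r : _} (I : Subset r) → Tuple D r → Pow D I
π I x (i , _) = x i

IsSubstructure : {D₁ D₂ : Set} {r₁ r₂ : _} →
  (P Q : Rel D₁ r₁) (R S : Rel D₂ r₂) (𝓘 : Fin r₂ → Subset r₁) → Set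
IsSubstructure {D₁} {D₂} {r₁} {r₂} P Q R S 𝓘 =
  Σ ((j : Fin r₂) → Pow D₁ (𝓘 j) → D₂) λ g →
    let G : Tuple D₁ r₁ → Tuple D₂ r₂
        G x j = g j (π (𝓘 j) x)
    in ((x : Tuple D₁ r₁) → P x → R (G x))
     × ((x : Tuple D₁ r₁) → Q x → ¬ P x → S (G x) × ¬ R (G x))

D3 : Set
D3 = Fin 3

pattern 𝟎 = zero
pattern 𝟏 = suc zero
pattern 𝟐 = suc (suc zero)

data C6 : D3 → D3 → Set where
  c00 : C6 𝟎 𝟎
  c01 : C6 𝟎 𝟏
  c10 : C6 𝟏 𝟎
  c12 : C6 𝟏 𝟐
  c21 : C6 𝟐 𝟏
  c22 : C6 𝟐 𝟐

C6* : D3 → D3 → Set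
C6* a b = C6 a b × ¬ (a ≡ 𝟎 × b ≡ 𝟎)

S₁ : Rel D3 3
S₁ x = C6 (x 𝟎) (x 𝟏)

R₁ : Rel D3 3
R₁ x = C6* (x 𝟎) (x 𝟏) ⊎ (C6 (x 𝟎) (x 𝟏) × x 𝟐 ≢ 𝟎)

data P₂′ : D3 → D3 → D3 → Set where
  p011 : P₂′ 𝟎 𝟏 𝟏
  p111 : P₂′ 𝟏 𝟏 𝟏
  p120 : P₂′ 𝟏 𝟐 𝟎
  p222 : P₂′ 𝟐 𝟐 𝟐
  p202 : P₂′ 𝟐 𝟎 𝟐

P₂ : Rel D3 3
P₂ x = P₂′ (x 𝟎) (x 𝟏) (x 𝟐)

Q₂ : Rel D3 3
Q₂ x = P₂ x ⊎ (x 𝟎 ≡ 𝟎 × x 𝟏 ≡ 𝟎 × x 𝟐 ≡ 𝟎)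

{-# OPTIONS --safe #-}
module Submission where

-- Both gaps are a single point: S₁ ∖ R₁ = {000} = Q₂ ∖ P₂. So it suffices to
-- give three binary functions, the j-th applied to the coordinates in I_j, whose
-- combined map sends 000 to 000 and every other point of S₁ into P₂.

open import Defs
open import Data.Fin using (Fin)
open import Data.Fin.Subset using (Subset; ∣_∣; ⁅_⁆; _∪_)
open import Data.Fin.Subset.Properties using (x∈⁅x⁆; x∈p∪q⁺)
open import Data.Product using (Σ; _×_; _,_)
open import Data.Sum using (inj₁; inj₂)
open import Data.Vec.Functional using ([]; _∷_)
open import Relation.Nullary using (¬_; contradiction)
open import Relation.Binary.PropositionalEquality using (_≡_; refl)

binaryMap : {D₁ D₂ : Set} {r₁ r₂ : _} (i k : Fin r₂ → Fin r₁)
  (f : Fin r₂ → D₁ → D₁ → D₂) → Tuple D₁ r₁ → Tuple D₂ r₂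
binaryMap i k f x j = f j (x (i j)) (x (k j))

binaryMap-substructure : {D₁ D₂ : Set} {r₁ r₂ : _}
  (P Q : Rel D₁ r₁) (R S : Rel D₂ r₂) (i k : Fin r₂ → Fin r₁)
  (f : Fin r₂ → D₁ → D₁ → D₂) →
  let G = binaryMap i k f in
  ((x : Tuple D₁ r₁) → P x → R (G x)) →
  ((x : Tuple D₁ r₁) → Q x → ¬ P x → S (G x) × ¬ R (G x)) →
  IsSubstructure P Q R S (λ j → ⁅ i j ⁆ ∪ ⁅ k j ⁆)
binaryMap-substructure _ _ _ _ i k f P⇒R Q∖P⇒S∖R = g , P⇒R , Q∖P⇒S∖R
  where
  g : ∀ j → Pow _ (⁅ i j ⁆ ∪ ⁅ k j ⁆) → _
  g j y = f j (y (i j , x∈p∪q⁺ (inj₁ (x∈⁅x⁆ (i j)))))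
              (y (k j , x∈p∪q⁺ (inj₂ (x∈⁅x⁆ (k j)))))

firstCoord : Fin 3 → Fin 3
firstCoord 𝟎 = 𝟎
firstCoord 𝟏 = 𝟏
firstCoord 𝟐 = 𝟎

secondCoord : Fin 3 → Fin 3
secondCoord 𝟎 = 𝟐
secondCoord 𝟏 = 𝟐
secondCoord 𝟐 = 𝟏

t₀ : D3 → D3 → D3
t₀ 𝟎 𝟎 = 𝟎
t₀ 𝟎 _ = 𝟏
t₀ 𝟏 _ = 𝟐
t₀ 𝟐 _ = 𝟏

t₁ : D3 → D3 → D3
t₁ 𝟎 𝟎 = 𝟎
t₁ 𝟎 _ = 𝟐
t₁ 𝟏 _ = 𝟏
t₁ 𝟐 _ = 𝟐

t₂ : D3 → D3 → D3
t₂ 𝟎 𝟏 = 𝟏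
t₂ 𝟏 𝟎 = 𝟐
t₂ 𝟏 𝟐 = 𝟐
t₂ 𝟐 𝟏 = 𝟏
t₂ _ _ = 𝟎

t : Fin 3 → D3 → D3 → D3
t 𝟎 = t₀
t 𝟏 = t₁
t 𝟐 = t₂

τ : Tuple D3 3 → Tuple D3 3
τ = binaryMap firstCoord secondCoord t

Origin : D3 → D3 → D3 → Set
Origin a b c = a ≡ 𝟎 × b ≡ 𝟎 × c ≡ 𝟎

R₁⇒S₁ : ∀ {x} → R₁ x → S₁ x
R₁⇒S₁ (inj₁ (s , _)) = s
R₁⇒S₁ (inj₂ (s , _)) = s

R₁⇒¬Origin : ∀ {a b c} → R₁ (a ∷ b ∷ c ∷ []) → ¬ Origin a b c
R₁⇒¬Origin (inj₁ (_ , ab≢00)) (a≡0 , b≡0 , _) = ab≢00 (a≡0 , b≡0)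
R₁⇒¬Origin (inj₂ (_ , c≢0))   (_ , _ , c≡0)   = c≢0 c≡0

-- Stated for a ∷ b ∷ c ∷ [] rather than an arbitrary tuple x, so that the
-- indices of C6 are variables and its constructors can be matched on.
S₁∖R₁⇒Origin : ∀ {a b} c → S₁ (a ∷ b ∷ c ∷ []) → ¬ R₁ (a ∷ b ∷ c ∷ []) →
  Origin a b c
S₁∖R₁⇒Origin 𝟎 c00 _  = refl , refl , refl
S₁∖R₁⇒Origin 𝟏 c00 ¬r = contradiction (inj₂ (c00 , λ ())) ¬r
S₁∖R₁⇒Origin 𝟐 c00 ¬r = contradiction (inj₂ (c00 , λ ())) ¬r
S₁∖R₁⇒Origin _ c01 ¬r = contradiction (inj₁ (c01 , λ { (_ , ()) })) ¬r
S₁∖R₁⇒Origin _ c10 ¬r = contradiction (inj₁ (c10 , λ { (() , _) })) ¬r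
S₁∖R₁⇒Origin _ c12 ¬r = contradiction (inj₁ (c12 , λ { (() , _) })) ¬r
S₁∖R₁⇒Origin _ c21 ¬r = contradiction (inj₁ (c21 , λ { (() , _) })) ¬r
S₁∖R₁⇒Origin _ c22 ¬r = contradiction (inj₁ (c22 , λ { (() , _) })) ¬r

τ-S₁∖Origin⊆P₂ : ∀ {a b} c → C6 a b → ¬ Origin a b c →
  P₂ (τ (a ∷ b ∷ c ∷ []))
τ-S₁∖Origin⊆P₂ 𝟎 c00 ¬o = contradiction (refl , refl , refl) ¬o
τ-S₁∖Origin⊆P₂ 𝟏 c00 _  = p120
τ-S₁∖Origin⊆P₂ 𝟐 c00 _  = p120
τ-S₁∖Origin⊆P₂ 𝟎 c01 _  = p011
τ-S₁∖Origin⊆P₂ 𝟏 c01 _  = p111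
τ-S₁∖Origin⊆P₂ 𝟐 c01 _  = p111
τ-S₁∖Origin⊆P₂ 𝟎 c10 _  = p202
τ-S₁∖Origin⊆P₂ 𝟏 c10 _  = p222
τ-S₁∖Origin⊆P₂ 𝟐 c10 _  = p222
τ-S₁∖Origin⊆P₂ _ c12 _  = p222
τ-S₁∖Origin⊆P₂ _ c21 _  = p111
τ-S₁∖Origin⊆P₂ _ c22 _  = p120

τ-Origin∈Q₂∖P₂ : ∀ {a b c} → Origin a b c →
  Q₂ (τ (a ∷ b ∷ c ∷ [])) × ¬ P₂ (τ (a ∷ b ∷ c ∷ []))
τ-Origin∈Q₂∖P₂ (refl , refl , refl) = inj₂ (refl , refl , refl) , λ ()

lemmaC5 : Σ (Fin 3 → Subset 3) λ 𝓘 →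
    ((j : Fin 3) → ∣ 𝓘 j ∣ ≡ 2) × IsSubstructure R₁ S₁ P₂ Q₂ 𝓘
lemmaC5 = _ , pairSizes ,
  binaryMap-substructure R₁ S₁ P₂ Q₂ firstCoord secondCoord t R₁⊆τ⁻¹P₂ S₁∖R₁⊆τ⁻¹Q₂∖P₂
  where
  pairSizes : (j : Fin 3) → ∣ ⁅ firstCoord j ⁆ ∪ ⁅ secondCoord j ⁆ ∣ ≡ 2
  pairSizes 𝟎 = refl
  pairSizes 𝟏 = refl
  pairSizes 𝟐 = refl

  R₁⊆τ⁻¹P₂ : (x : Tuple D3 3) → R₁ x → P₂ (τ x)
  R₁⊆τ⁻¹P₂ x r = τ-S₁∖Origin⊆P₂ (x 𝟐) (R₁⇒S₁ {x} r) (R₁⇒¬Origin {x 𝟎} {x 𝟏} r)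

  S₁∖R₁⊆τ⁻¹Q₂∖P₂ : (x : Tuple D3 3) → S₁ x → ¬ R₁ x → Q₂ (τ x) × ¬ P₂ (τ x)
  S₁∖R₁⊆τ⁻¹Q₂∖P₂ x s ¬r = τ-Origin∈Q₂∖P₂ (S₁∖R₁⇒Origin {x 𝟎} {x 𝟏} (x 𝟐) s ¬r)
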